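{- For $n\ge1$ and $0\le k\le n-1$, $d_{n,k}=d_{n,n-k-1}$, where $d_{n,k}$ is the number of $\sigma\in\mathcal{R}_n^B$ with $\mathrm{des}(\sigma)=k$.
   Context: $[n]=\{1,\dots,n\}$, $\langle n\rangle=\{0,\pm1,\dots,\pm n\}$. A type $B$ set partition of $\langle n\rangle$ without zero block is encoded as $\pi=\pi_1\mid\cdots\mid\pi_k$: nonempty sets of nonzero integers with the sets $\{|a|:a\in\pi_i\}$ partitioning $[n]$, the element of smallest absolute value $m_i$ of $\pi_i$ positive, $m_1<\cdots<m_k$. It is merging-free if there is no $i\ge2$ with $\max_{a\in\pi_{i-1}}|a|<m_i$. $\mathrm{Flatten}(\pi)$ is the word obtained by concatenating the blocks $\pi_1,\pi_2,\dots$, each written in increasing order of absolute value. $\mathcal{R}_n^B$ is the set of $\mathrm{Flatten}(\pi)$ over merging-free $\pi$. For $\sigma=\sigma_1\cdots\sigma_n$, $i\in[n-1]$ is a descent if $\sigma_i>\sigma_{i+1}$ in the usual order of integers; $\mathrm{des}(\sigma)$ is the number of descents. -}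

module Defs where

open import Data.Nat as ℕ using (ℕ; suc; zero)
open import Data.Integer as ℤ using (ℤ; ∣_∣; +_)
open import Data.List using (List; []; _∷_; map; concat; upTo)
open import Data.List.NonEmpty as List⁺ using (List⁺; head; last; toList)
open import Data.List.Relation.Unary.All using (All)
open import Data.List.Relation.Unary.Linked using (Linked)
open import Data.List.Relation.Binary.Permutation.Propositional using (_↭_)
open import Data.Product using (Σ; _×_; ∃; proj₁)
open import Relation.Nullary using (¬_)
open import Relation.Nullary.Decidable using (⌊_⌋)
open import Relation.Binary.PropositionalEquality using (_≡_)
open import Data.Bool using (if_then_else_)

-- A block π_i is a nonempty list of nonzero integers, written in increasing
-- order of absolute value (this list determines the set uniquely).
Block : Set
Block = List⁺ ℤ

-- A type B set partition of ⟨n⟩ without zero block, π = π_1 | ... | π_k,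
-- encoded as the list of its blocks in order.
record IsTypeBPartition (n : ℕ) (π : List Block) : Set where
  field
    blockSorted : All (λ B → Linked (λ a b → ∣ a ∣ ℕ.< ∣ b ∣) (toList B)) π
    -- the absolute-value sets of the blocks partition [n] (so all entries are nonzero)
    absPartition : map ∣_∣ (concat (map toList π)) ↭ map suc (upTo n)
    minPositive : All (λ B → + 0 ℤ.< head B) π
    minIncreasing : Linked (λ B C → head B ℤ.< head C) π

-- merging-free: no i ≥ 2 with max_{a ∈ π_{i-1}} |a| < m_i
MergingFree : List Block → Set
MergingFree π = Linked (λ B C → ¬ (∣ last B ∣ ℕ.< ∣ head C ∣)) π

Flatten : List Block → List ℤ
Flatten π = concat (map toList π)

InR : ℕ → List ℤ → Set
InR n σ = ∃ λ (π : List Block) → IsTypeBPartition n π × MergingFree π × Flatten π ≡ σ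

des : List ℤ → ℕ
des [] = 0
des (a ∷ []) = 0
des (a ∷ b ∷ σ) = (if ⌊ b ℤ.<? a ⌋ then 1 else 0) ℕ.+ des (b ∷ σ)

RDes : ℕ → ℕ → Set
RDes n k = Σ (List ℤ) (λ σ → InR n σ × des σ ≡ k)

-- |RDes n k| = |RDes n k'| : a bijection between the two sets of WORDS,
-- i.e. maps in both directions that are mutually inverse on the underlying
-- words (witnesses are irrelevant; only the word σ is an element of R^B_n).
SameCount : ℕ → ℕ → ℕ → Set
SameCount n k k' =
  Σ (RDes n k → RDes n k') λ f → Σ (RDes n k' → RDes n k) λ g →
    (∀ x x' → proj₁ x ≡ proj₁ x' → proj₁ (f x) ≡ proj₁ (f x')) ×
    (∀ y y' → proj₁ y ≡ proj₁ y' → proj₁ (g y) ≡ proj₁ (g y')) ×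
    (∀ x → proj₁ (g (f x)) ≡ proj₁ x) × (∀ y → proj₁ (f (g y)) ≡ proj₁ y)

{-# OPTIONS --safe #-}
module Submission where

-- The map ψ = negateRises negates every letter of a signed word except the first one and those
-- whose absolute value is smaller than that of their predecessor. Since ψ preserves absolute
-- values it is an involution. If π is merging-free, the minimum of each block lies strictly
-- between the extreme absolute values of the previous block; so in σ = Flatten π the absolute
-- value rises inside blocks, falls at block boundaries, and every block but the last has at least
-- two elements. Hence ψ σ = Flatten π′, where π′ negates all non-minimal elements of the blocks
-- of π, and π′ is again merging-free. At each position exactly one of σ and ψ σ has a descent:
-- inside a block the comparison is decided by the sign of the later letter, at a boundary by the
-- sign of the last letter of the block, and ψ flips both signs. So des σ + des (ψ σ) = n − 1.

open import Defs
open import Data.Nat as ℕ using (ℕ; suc; _+_; _∸_; _≤_; z≤n; s≤s)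
import Data.Nat.Properties as ℕ
open import Data.Integer as ℤ using (ℤ; ∣_∣; +_; -[1+_]; +[1+_]; -_)
import Data.Integer.Properties as ℤ
open import Data.Bool using (if_then_else_)
open import Data.Maybe using (just)
open import Data.Maybe.Relation.Binary.Connected using (Connected; just; just-nothing)
open import Data.List as List using (List; []; _∷_; _++_; map; length; upTo; concatMap)
import Data.List.Properties as List
open import Data.List.NonEmpty as List⁺ using (List⁺; _∷_; head; tail; last; toList)
open import Data.List.Relation.Unary.All as All using (All; []; _∷_)
open import Data.List.Relation.Unary.All.Properties as All using ()
open import Data.List.Relation.Unary.Linked as Linked using (Linked; []; [-]; _∷_)
open import Data.List.Relation.Unary.Linked.Properties as Linked using (AllPairs⇒Linked)
open import Data.List.Relation.Unary.Unique.Propositional using (Unique)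
import Data.List.Relation.Unary.Unique.Propositional.Properties as Unique
open import Data.List.Relation.Binary.Permutation.Propositional using (_↭_; ↭-sym; ↭⇒↭ₛ)
open import Data.List.Relation.Binary.Permutation.Propositional.Properties using (↭-length)
import Data.List.Relation.Binary.Permutation.Setoid.Properties as Permutationₛ
open import Data.Product using (_×_; _,_; proj₁; proj₂)
open import Function.Base using (_on_; _∘_)
open import Function.Bundles using (_⇔_; mk⇔)
open import Relation.Binary.Construct.Intersection using (_∩_)
open import Relation.Nullary using (¬_; yes; no; contradiction)
open import Relation.Nullary.Decidable using (⌊_⌋; does-⇔; isYes≗does)
open import Relation.Binary.PropositionalEquality
open import Algebra.Properties.CommutativeSemigroup ℕ.+-commutativeSemigroup using (interchange)

last-∷ : ∀ {A : Set} (x y : A) ys → last (x ∷ y ∷ ys) ≡ last (y ∷ ys)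
last-∷ x y ys with List.initLast ys
... | [] = refl
... | _ List.∷ʳ′ _ = refl

last-map : ∀ {A B : Set} (f : A → B) (xs : List⁺ A) → last (List⁺.map f xs) ≡ f (last xs)
last-map f (x ∷ xs) = go x xs
  where
  open ≡-Reasoning
  go : ∀ x xs → last (List⁺.map f (x ∷ xs)) ≡ f (last (x ∷ xs))
  go x [] = refl
  go x (y ∷ ys) = begin
    last (f x ∷ f y ∷ map f ys) ≡⟨ last-∷ (f x) (f y) (map f ys) ⟩
    last (f y ∷ map f ys)       ≡⟨ go y ys ⟩
    f (last (y ∷ ys))           ≡⟨ cong f (last-∷ x y ys) ⟨
    f (last (x ∷ y ∷ ys))       ∎

Linked-++⁻-last : ∀ {A : Set} {R : A → A → Set} (xs : List⁺ A) {y ys} →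
                  Linked R (toList xs ++ y ∷ ys) → R (last xs) y × Linked R (y ∷ ys)
Linked-++⁻-last {R = R} (x ∷ xs) = go x xs
  where
  go : ∀ x xs {y ys} → Linked R (x ∷ xs ++ y ∷ ys) → R (last (x ∷ xs)) y × Linked R (y ∷ ys)
  go x [] (Rxy ∷ Ryys) = Rxy , Ryys
  go x (z ∷ zs) (_ ∷ Rzs) with go z zs Rzs
  ... | Rly , Ryys = subst (λ l → R l _) (sym (last-∷ x z zs)) Rly , Ryys

descent : ℤ → ℤ → ℕ
descent a b = if ⌊ b ℤ.<? a ⌋ then 1 else 0

descent-cong : ∀ {a b c d} → b ℤ.< a ⇔ d ℤ.< c → descent a b ≡ descent c d
descent-cong {a} {b} {c} {d} b<a⇔d<c = cong (λ x → if x then 1 else 0) (begin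
  ⌊ b ℤ.<? a ⌋  ≡⟨ isYes≗does (b ℤ.<? a) ⟩
  _             ≡⟨ does-⇔ b<a⇔d<c (b ℤ.<? a) (d ℤ.<? c) ⟩
  _             ≡⟨ isYes≗does (d ℤ.<? c) ⟨
  ⌊ d ℤ.<? c ⌋  ∎)
  where open ≡-Reasoning

∣b∣<∣a∣⇒[b<a⇔0<a] : ∀ {a b} → ∣ b ∣ ℕ.< ∣ a ∣ → b ℤ.< a ⇔ + 0 ℤ.< a
∣b∣<∣a∣⇒[b<a⇔0<a] {+ m} {+ n} n<m = mk⇔ (λ _ → ℤ.+<+ (ℕ.≤-trans (s≤s z≤n) n<m)) (λ _ → ℤ.+<+ n<m)
∣b∣<∣a∣⇒[b<a⇔0<a] {+ m} { -[1+ n ]} n<m = mk⇔ (λ _ → ℤ.+<+ (ℕ.≤-trans (s≤s z≤n) n<m)) (λ _ → ℤ.-<+)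
∣b∣<∣a∣⇒[b<a⇔0<a] { -[1+ m ]} {+ n} _ = mk⇔ (λ ()) (λ ())
∣b∣<∣a∣⇒[b<a⇔0<a] { -[1+ m ]} { -[1+ n ]} n<m =
  mk⇔ (λ { (ℤ.-<- m<n) → contradiction (ℕ.≤-pred n<m) (ℕ.<-asym m<n) }) (λ ())

∣a∣<∣b∣⇒[b<a⇔b<0] : ∀ {a b} → ∣ a ∣ ℕ.< ∣ b ∣ → b ℤ.< a ⇔ b ℤ.< + 0
∣a∣<∣b∣⇒[b<a⇔b<0] {+ m} {+ n} m<n =
  mk⇔ (λ { (ℤ.+<+ n<m) → contradiction m<n (ℕ.<-asym n<m) }) (λ { (ℤ.+<+ ()) })
∣a∣<∣b∣⇒[b<a⇔b<0] {+ m} { -[1+ n ]} _ = mk⇔ (λ _ → ℤ.-<+) (λ _ → ℤ.-<+)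
∣a∣<∣b∣⇒[b<a⇔b<0] { -[1+ m ]} {+ n} _ = mk⇔ (λ ()) (λ { (ℤ.+<+ ()) })
∣a∣<∣b∣⇒[b<a⇔b<0] { -[1+ m ]} { -[1+ n ]} m<n = mk⇔ (λ _ → ℤ.-<+) (λ _ → ℤ.-<- (ℕ.≤-pred m<n))

0<a<b⇒∣a∣<∣b∣ : ∀ {a b} → + 0 ℤ.< a → a ℤ.< b → ∣ a ∣ ℕ.< ∣ b ∣
0<a<b⇒∣a∣<∣b∣ {+ m} {+ n} _ (ℤ.+<+ m<n) = m<n

descent-to-smaller : ∀ a b → ∣ b ∣ ℕ.< ∣ a ∣ → descent a b ≡ descent a (+ 0)
descent-to-smaller a b b<a = descent-cong (∣b∣<∣a∣⇒[b<a⇔0<a] b<a)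

descent-to-larger : ∀ a b → ∣ a ∣ ℕ.< ∣ b ∣ → descent a b ≡ descent (+ 0) b
descent-to-larger a b a<b = descent-cong (∣a∣<∣b∣⇒[b<a⇔b<0] a<b)

descent-±-to-0 : ∀ x → 0 ℕ.< ∣ x ∣ → descent x (+ 0) + descent (- x) (+ 0) ≡ 1
descent-±-to-0 +[1+ m ] _ = refl
descent-±-to-0 -[1+ m ] _ = refl

descent-0-to-± : ∀ x → 0 ℕ.< ∣ x ∣ → descent (+ 0) x + descent (+ 0) (- x) ≡ 1
descent-0-to-± +[1+ m ] _ = refl
descent-0-to-± -[1+ m ] _ = refl

negateIfRise : ℤ → ℤ → ℤ
negateIfRise p b = if ⌊ ∣ b ∣ ℕ.<? ∣ p ∣ ⌋ then b else - b

negateRisesFrom : ℤ → List ℤ → List ℤ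
negateRisesFrom p [] = []
negateRisesFrom p (b ∷ σ) = negateIfRise p b ∷ negateRisesFrom b σ

negateRises : List ℤ → List ℤ
negateRises [] = []
negateRises (a ∷ σ) = a ∷ negateRisesFrom a σ

negateIfRise-fall : ∀ p b → ∣ b ∣ ℕ.< ∣ p ∣ → negateIfRise p b ≡ b
negateIfRise-fall p b b<p with ∣ b ∣ ℕ.<? ∣ p ∣
... | yes _ = refl
... | no b≮p = contradiction b<p b≮p

negateIfRise-rise : ∀ p b → ¬ ∣ b ∣ ℕ.< ∣ p ∣ → negateIfRise p b ≡ - b
negateIfRise-rise p b b≮p with ∣ b ∣ ℕ.<? ∣ p ∣
... | yes b<p = contradiction b<p b≮p
... | no _ = refl

∣negateIfRise∣ : ∀ p b → ∣ negateIfRise p b ∣ ≡ ∣ b ∣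
∣negateIfRise∣ p b with ∣ b ∣ ℕ.<? ∣ p ∣
... | yes _ = refl
... | no _ = ℤ.∣-i∣≡∣i∣ b

negateIfRise-involutive : ∀ p p′ b → ∣ p′ ∣ ≡ ∣ p ∣ → negateIfRise p′ (negateIfRise p b) ≡ b
negateIfRise-involutive p p′ b ∣p′∣≡∣p∣ with ∣ b ∣ ℕ.<? ∣ p ∣
... | yes b<p = negateIfRise-fall p′ b (subst (∣ b ∣ ℕ.<_) (sym ∣p′∣≡∣p∣) b<p)
... | no b≮p = trans (negateIfRise-rise p′ (- b) -b≮p′) (ℤ.neg-involutive b)
  where
  -b≮p′ : ¬ ∣ - b ∣ ℕ.< ∣ p′ ∣
  -b≮p′ = subst₂ (λ x y → ¬ x ℕ.< y) (sym (ℤ.∣-i∣≡∣i∣ b)) (sym ∣p′∣≡∣p∣) b≮p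

negateRisesFrom-involutive : ∀ p p′ σ → ∣ p′ ∣ ≡ ∣ p ∣ → negateRisesFrom p′ (negateRisesFrom p σ) ≡ σ
negateRisesFrom-involutive p p′ [] _ = refl
negateRisesFrom-involutive p p′ (b ∷ σ) ∣p′∣≡∣p∣ =
  cong₂ _∷_ (negateIfRise-involutive p p′ b ∣p′∣≡∣p∣)
            (negateRisesFrom-involutive b (negateIfRise p b) σ (∣negateIfRise∣ p b))

negateRises-involutive : ∀ σ → negateRises (negateRises σ) ≡ σ
negateRises-involutive [] = refl
negateRises-involutive (a ∷ σ) = cong (a ∷_) (negateRisesFrom-involutive a a σ refl)

-- Relations between consecutive entries of a list of pairs, read as two words side by side.

Follows : ℤ × ℤ → ℤ × ℤ → Set
Follows (a , _) (b , b′) = b′ ≡ negateIfRise a b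

OppositeDescents : ℤ × ℤ → ℤ × ℤ → Set
OppositeDescents (a , a′) (b , b′) = descent a b + descent a′ b′ ≡ 1

negateRisesFrom-map-proj₁ : ∀ {a a′} ps → Linked Follows ((a , a′) ∷ ps) →
                            negateRisesFrom a (map proj₁ ps) ≡ map proj₂ ps
negateRisesFrom-map-proj₁ [] _ = refl
negateRisesFrom-map-proj₁ ((b , b′) ∷ ps) (b′≡ψb ∷ follows) =
  cong₂ _∷_ (sym b′≡ψb) (negateRisesFrom-map-proj₁ ps follows)

des-map-proj₁+des-map-proj₂ : ∀ ps → Linked OppositeDescents ps →
                              des (map proj₁ ps) + des (map proj₂ ps) ≡ length ps ∸ 1
des-map-proj₁+des-map-proj₂ [] [] = refl
des-map-proj₁+des-map-proj₂ (_ ∷ []) [-] = refl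
des-map-proj₁+des-map-proj₂ ((a , a′) ∷ (b , b′) ∷ ps) (opposite ∷ opposites) = begin
  (descent a b + des (b ∷ map proj₁ ps)) + (descent a′ b′ + des (b′ ∷ map proj₂ ps))
    ≡⟨ interchange (descent a b) _ (descent a′ b′) _ ⟩
  (descent a b + descent a′ b′) + (des (b ∷ map proj₁ ps) + des (b′ ∷ map proj₂ ps))
    ≡⟨ cong₂ _+_ opposite (des-map-proj₁+des-map-proj₂ ((b , b′) ∷ ps) opposites) ⟩
  1 + length ps
    ∎
  where open ≡-Reasoning

rise-step : ∀ {a a′ b} → ∣ a′ ∣ ≡ ∣ a ∣ → ∣ a ∣ ℕ.< ∣ b ∣ → (Follows ∩ OppositeDescents) (a , a′) (b , - b)
rise-step {a} {a′} {b} ∣a′∣≡∣a∣ a<b =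
  sym (negateIfRise-rise a b (ℕ.<⇒≯ a<b)) ,
  (begin
    descent a b + descent a′ (- b)        ≡⟨ cong₂ _+_ (descent-to-larger a b a<b) (descent-to-larger a′ (- b) a′<-b) ⟩
    descent (+ 0) b + descent (+ 0) (- b) ≡⟨ descent-0-to-± b (ℕ.<-≤-trans (s≤s z≤n) a<b) ⟩
    1                                     ∎)
  where
  open ≡-Reasoning
  a′<-b : ∣ a′ ∣ ℕ.< ∣ - b ∣
  a′<-b = subst₂ ℕ._<_ (sym ∣a′∣≡∣a∣) (sym (ℤ.∣-i∣≡∣i∣ b)) a<b

fall-step : ∀ {a b} → ∣ b ∣ ℕ.< ∣ a ∣ → (Follows ∩ OppositeDescents) (a , - a) (b , b)
fall-step {a} {b} b<a =
  sym (negateIfRise-fall a b b<a) ,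
  (begin
    descent a b + descent (- a) b         ≡⟨ cong₂ _+_ (descent-to-smaller a b b<a) (descent-to-smaller (- a) b b<-a) ⟩
    descent a (+ 0) + descent (- a) (+ 0) ≡⟨ descent-±-to-0 a (ℕ.<-≤-trans (s≤s z≤n) b<a) ⟩
    1                                     ∎)
  where
  open ≡-Reasoning
  b<-a : ∣ b ∣ ℕ.< ∣ - a ∣
  b<-a = subst (∣ b ∣ ℕ.<_) (sym (ℤ.∣-i∣≡∣i∣ a)) b<a

AbsIncreasing : List ℤ → Set
AbsIncreasing = Linked (ℕ._<_ on ∣_∣)

-- Merging-freeness, with the upper bound made strict by the distinctness of absolute values.
Overlaps : Block → Block → Set
Overlaps B C = ∣ head B ∣ ℕ.< ∣ head C ∣ × ∣ head C ∣ ℕ.< ∣ last B ∣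

HeadBelow : ℤ → Block → Set
HeadBelow l C = ∣ head C ∣ ℕ.< ∣ l ∣

negateTail : Block → Block
negateTail B = head B ∷ map -_ (tail B)

pairBlock : Block → List (ℤ × ℤ)
pairBlock B = (head B , head B) ∷ map (λ x → x , - x) (tail B)

pairs : List Block → List (ℤ × ℤ)
pairs = concatMap pairBlock

map-proj₁-pairs : ∀ π → map proj₁ (pairs π) ≡ Flatten π
map-proj₁-pairs [] = refl
map-proj₁-pairs ((h ∷ t) ∷ π) = cong (h ∷_) (begin
  map proj₁ (map (λ x → x , - x) t ++ pairs π)             ≡⟨ List.map-++ proj₁ _ (pairs π) ⟩
  map proj₁ (map (λ x → x , - x) t) ++ map proj₁ (pairs π) ≡⟨ cong₂ _++_ (sym (List.map-∘ t)) (map-proj₁-pairs π) ⟩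
  map (λ x → x) t ++ Flatten π                              ≡⟨ cong (_++ Flatten π) (List.map-id t) ⟩
  t ++ Flatten π                                            ∎)
  where open ≡-Reasoning

map-proj₂-pairs : ∀ π → map proj₂ (pairs π) ≡ Flatten (map negateTail π)
map-proj₂-pairs [] = refl
map-proj₂-pairs ((h ∷ t) ∷ π) = cong (h ∷_) (begin
  map proj₂ (map (λ x → x , - x) t ++ pairs π)             ≡⟨ List.map-++ proj₂ _ (pairs π) ⟩
  map proj₂ (map (λ x → x , - x) t) ++ map proj₂ (pairs π) ≡⟨ cong₂ _++_ (sym (List.map-∘ t)) (map-proj₂-pairs π) ⟩
  map -_ t ++ Flatten (map negateTail π)                    ∎)
  where open ≡-Reasoning

mutual
  pairs-linked : ∀ π → All (AbsIncreasing ∘ toList) π → Linked Overlaps π →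
                 Linked (Follows ∩ OppositeDescents) (pairs π)
  pairs-linked [] _ _ = []
  pairs-linked ((h ∷ []) ∷ []) _ _ = [-]
  pairs-linked ((h ∷ []) ∷ C ∷ π) _ ((h<c , c<h) ∷ _) = contradiction c<h (ℕ.<-asym h<c)
  pairs-linked ((h ∷ x ∷ t) ∷ π) ((h<x ∷ x↑) ∷ π↑) overlaps =
    rise-step refl h<x ∷ tail-pairs-linked x t π x↑ π↑ (Linked.tail overlaps) (next-head-below overlaps)
    where
    next-head-below : Linked Overlaps ((h ∷ x ∷ t) ∷ π) → Connected HeadBelow (just (last (x ∷ t))) (List.head π)
    next-head-below [-] = just-nothing
    next-head-below ((_ , c<l) ∷ _) = just (subst (λ l → _ ℕ.< ∣ l ∣) (last-∷ h x t) c<l)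

  tail-pairs-linked : ∀ a t π → AbsIncreasing (a ∷ t) → All (AbsIncreasing ∘ toList) π → Linked Overlaps π →
                      Connected HeadBelow (just (last (a ∷ t))) (List.head π) →
                      Linked (Follows ∩ OppositeDescents) ((a , - a) ∷ map (λ x → x , - x) t ++ pairs π)
  tail-pairs-linked a (x ∷ t) π (a<x ∷ x↑) π↑ overlaps below =
    rise-step (ℤ.∣-i∣≡∣i∣ a) a<x ∷
    tail-pairs-linked x t π x↑ π↑ overlaps
      (subst (λ l → Connected HeadBelow (just l) (List.head π)) (last-∷ a x t) below)
  tail-pairs-linked a [] [] _ _ _ _ = [-]
  tail-pairs-linked a [] (C ∷ π) _ π↑ overlaps (just c<a) = fall-step c<a ∷ pairs-linked (C ∷ π) π↑ overlaps

negateRises-pairs : ∀ π → Linked Follows (pairs π) → negateRises (map proj₁ (pairs π)) ≡ map proj₂ (pairs π)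
negateRises-pairs [] _ = refl
negateRises-pairs ((h ∷ t) ∷ π) follows = cong (h ∷_) (negateRisesFrom-map-proj₁ _ follows)

module _ {π} (π↑ : All (AbsIncreasing ∘ toList) π) (overlaps : Linked Overlaps π) where

  private
    follows×opposite : Linked Follows (pairs π) × Linked OppositeDescents (pairs π)
    follows×opposite = Linked.unzip (pairs-linked π π↑ overlaps)

  negateRises-Flatten : negateRises (Flatten π) ≡ Flatten (map negateTail π)
  negateRises-Flatten = begin
    negateRises (Flatten π)              ≡⟨ cong negateRises (map-proj₁-pairs π) ⟨
    negateRises (map proj₁ (pairs π))    ≡⟨ negateRises-pairs π (proj₁ follows×opposite) ⟩
    map proj₂ (pairs π)                  ≡⟨ map-proj₂-pairs π ⟩
    Flatten (map negateTail π)           ∎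
    where open ≡-Reasoning

  des-Flatten+des-negateRises : des (Flatten π) + des (negateRises (Flatten π)) ≡ length (Flatten π) ∸ 1
  des-Flatten+des-negateRises = begin
    des (Flatten π) + des (negateRises (Flatten π))
      ≡⟨ cong₂ (λ σ τ → des σ + des τ) (map-proj₁-pairs π) (trans (map-proj₂-pairs π) (sym negateRises-Flatten)) ⟨
    des (map proj₁ (pairs π)) + des (map proj₂ (pairs π))
      ≡⟨ des-map-proj₁+des-map-proj₂ (pairs π) (proj₂ follows×opposite) ⟩
    length (pairs π) ∸ 1
      ≡⟨ cong (_∸ 1) (trans (sym (List.length-map proj₁ (pairs π))) (cong length (map-proj₁-pairs π))) ⟩
    length (Flatten π) ∸ 1
      ∎
    where open ≡-Reasoning

mergingFree⇒overlaps : ∀ {π} → All (λ B → + 0 ℤ.< head B) π → Linked (λ B C → head B ℤ.< head C) π →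
                       MergingFree π → Linked ((λ x y → x ≢ y) on ∣_∣) (Flatten π) → Linked Overlaps π
mergingFree⇒overlaps {[]} _ _ _ _ = []
mergingFree⇒overlaps {_ ∷ []} _ _ _ _ = [-]
mergingFree⇒overlaps {B ∷ C ∷ π} (0<b ∷ 0<cs) (b<c ∷ b<cs) (l≮c ∷ mergingFree) distinct
  with Linked-++⁻-last B distinct
... | l≢c , distinct′ =
  (0<a<b⇒∣a∣<∣b∣ 0<b b<c , ℕ.≤∧≢⇒< (ℕ.≮⇒≥ l≮c) (≢-sym l≢c)) ∷
  mergingFree⇒overlaps 0<cs b<cs mergingFree distinct′

module _ {n π} (isB : IsTypeBPartition n π) where
  open IsTypeBPartition isB

  abs-Flatten-unique : Unique (map ∣_∣ (Flatten π))
  abs-Flatten-unique = Permutationₛ.Unique-resp-↭ (setoid ℕ) (↭⇒↭ₛ (↭-sym absPartition))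
                         (Unique.map⁺ ℕ.suc-injective (Unique.upTo⁺ n))

  length-Flatten : length (Flatten π) ≡ n
  length-Flatten = begin
    length (Flatten π)             ≡⟨ List.length-map ∣_∣ (Flatten π) ⟨
    length (map ∣_∣ (Flatten π))   ≡⟨ ↭-length absPartition ⟩
    length (map suc (upTo n))      ≡⟨ List.length-map suc (upTo n) ⟩
    length (upTo n)                ≡⟨ List.length-upTo n ⟩
    n                              ∎
    where open ≡-Reasoning

  overlaps : MergingFree π → Linked Overlaps π
  overlaps mergingFree = mergingFree⇒overlaps minPositive minIncreasing mergingFree
                           (Linked.map⁻ (AllPairs⇒Linked abs-Flatten-unique))

map-abs-negateTail : ∀ B → List⁺.map ∣_∣ (negateTail B) ≡ List⁺.map ∣_∣ B
map-abs-negateTail B = cong (∣ head B ∣ ∷_) (begin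
  map ∣_∣ (map -_ (tail B))    ≡⟨ List.map-∘ (tail B) ⟨
  map (∣_∣ ∘ -_) (tail B)      ≡⟨ List.map-cong ℤ.∣-i∣≡∣i∣ (tail B) ⟩
  map ∣_∣ (tail B)             ∎)
  where open ≡-Reasoning

∣last∘negateTail∣ : ∀ B → ∣ last (negateTail B) ∣ ≡ ∣ last B ∣
∣last∘negateTail∣ B = begin
  ∣ last (negateTail B) ∣              ≡⟨ last-map ∣_∣ (negateTail B) ⟨
  last (List⁺.map ∣_∣ (negateTail B))  ≡⟨ cong last (map-abs-negateTail B) ⟩
  last (List⁺.map ∣_∣ B)               ≡⟨ last-map ∣_∣ B ⟩
  ∣ last B ∣                           ∎
  where open ≡-Reasoning

map-abs-Flatten-negateTail : ∀ π → map ∣_∣ (Flatten (map negateTail π)) ≡ map ∣_∣ (Flatten π)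
map-abs-Flatten-negateTail [] = refl
map-abs-Flatten-negateTail (B ∷ π) = begin
  map ∣_∣ (toList (negateTail B) ++ Flatten (map negateTail π))
    ≡⟨ List.map-++ ∣_∣ (toList (negateTail B)) _ ⟩
  map ∣_∣ (toList (negateTail B)) ++ map ∣_∣ (Flatten (map negateTail π))
    ≡⟨ cong₂ _++_ (cong toList (map-abs-negateTail B)) (map-abs-Flatten-negateTail π) ⟩
  map ∣_∣ (toList B) ++ map ∣_∣ (Flatten π)
    ≡⟨ List.map-++ ∣_∣ (toList B) _ ⟨
  map ∣_∣ (toList B ++ Flatten π)
    ∎
  where open ≡-Reasoning

negateTail-absIncreasing : ∀ B → AbsIncreasing (toList B) → AbsIncreasing (toList (negateTail B))
negateTail-absIncreasing B B↑ =
  Linked.map⁻ (subst (Linked ℕ._<_) (sym (cong toList (map-abs-negateTail B))) (Linked.map⁺ B↑))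

negateTail-isTypeBPartition : ∀ {n π} → IsTypeBPartition n π → IsTypeBPartition n (map negateTail π)
negateTail-isTypeBPartition {n} {π} isB = record
  { blockSorted   = All.map⁺ (All.map (λ {B} → negateTail-absIncreasing B) blockSorted)
  ; absPartition  = subst (_↭ map suc (upTo n)) (sym (map-abs-Flatten-negateTail π)) absPartition
  ; minPositive   = All.map⁺ minPositive
  ; minIncreasing = Linked.map⁺ minIncreasing
  }
  where open IsTypeBPartition isB

negateTail-mergingFree : ∀ {π} → MergingFree π → MergingFree (map negateTail π)
negateTail-mergingFree = Linked.map⁺ ∘ Linked.map λ {B} {C} l≮c →
  l≮c ∘ subst (ℕ._< ∣ head C ∣) (∣last∘negateTail∣ B)

negateRises-InR : ∀ {n σ} → InR n σ → InR n (negateRises σ)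
negateRises-InR (π , isB , mergingFree , refl) =
  map negateTail π , negateTail-isTypeBPartition isB , negateTail-mergingFree mergingFree ,
  sym (negateRises-Flatten (IsTypeBPartition.blockSorted isB) (overlaps isB mergingFree))

des+des∘negateRises : ∀ {n σ} → InR n σ → des σ + des (negateRises σ) ≡ n ∸ 1
des+des∘negateRises (π , isB , mergingFree , refl) =
  trans (des-Flatten+des-negateRises (IsTypeBPartition.blockSorted isB) (overlaps isB mergingFree))
        (cong (_∸ 1) (length-Flatten isB))

involution⇒SameCount : ∀ {n m} (φ : List ℤ → List ℤ) → (∀ σ → φ (φ σ) ≡ σ) →
                       (∀ {σ} → InR n σ → InR n (φ σ)) → (∀ {σ} → InR n σ → des σ + des (φ σ) ≡ m) →
                       ∀ {k} → k ≤ m → SameCount n k (m ∸ k)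
involution⇒SameCount {n} {m} φ φ∘φ≡id φ-InR des+des∘φ {k} k≤m =
  forth , back , (λ _ _ → cong φ) , (λ _ _ → cong φ) , φ∘φ≡id ∘ proj₁ , φ∘φ≡id ∘ proj₁
  where
  des∘φ : ∀ {σ} → InR n σ → des (φ σ) ≡ m ∸ des σ
  des∘φ {σ} σ∈R = trans (sym (ℕ.m+n∸m≡n (des σ) (des (φ σ)))) (cong (_∸ des σ) (des+des∘φ σ∈R))
  forth : RDes n k → RDes n (m ∸ k)
  forth (σ , σ∈R , desσ≡k) = φ σ , φ-InR σ∈R , trans (des∘φ σ∈R) (cong (m ∸_) desσ≡k)
  back : RDes n (m ∸ k) → RDes n k
  back (σ , σ∈R , desσ≡m∸k) =
    φ σ , φ-InR σ∈R , trans (des∘φ σ∈R) (trans (cong (m ∸_) desσ≡m∸k) (ℕ.m∸[m∸n]≡n k≤m))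

mainTheorem12 : (n k : ℕ) → 1 ≤ n → k ≤ n ∸ 1 → SameCount n k (n ∸ k ∸ 1)
mainTheorem12 n k _ k≤n∸1 =
  subst (SameCount n k) n∸1∸k≡n∸k∸1
    (involution⇒SameCount negateRises negateRises-involutive negateRises-InR des+des∘negateRises k≤n∸1)
  where
  n∸1∸k≡n∸k∸1 : n ∸ 1 ∸ k ≡ n ∸ k ∸ 1
  n∸1∸k≡n∸k∸1 = trans (ℕ.∸-+-assoc n 1 k) (trans (cong (n ∸_) (ℕ.+-comm 1 k)) (sym (ℕ.∸-+-assoc n k 1)))
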